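{- Let $h$ be a natural number, let $G$ be a graph with a tree-decomposition $(T,\beta)$ of adhesion size at most $h$, and let $x \in V(T)$. (1) If the torso $\tau(x)$ excludes $K_h$ as a minor, then $G_x$ excludes $K_{h+1}$ as a minor. (2) If $\tau(x)$ has at most $h$ vertices of degree larger than $h$, then $G_x$ has at most $h$ vertices with degree larger than $h+2^{h+1}$.
   Context: A tree-decomposition of $G$ is a pair $(T,\beta)$ with $T$ a tree and $\beta: V(T)\to 2^{V(G)}$ such that every edge of $G$ has both endpoints in some $\beta(y)$, and for each $v\in V(G)$ the nodes $y$ with $v\in\beta(y)$ induce a nonempty subtree of $T$. An adhesion of $x$ is any nonempty set $\beta(x)\cap\beta(y)$ with $y\in V(T)\setminus\{x\}$. The adhesion size of $(T,\beta)$ is $\max_{y\neq z\in V(T)}|\beta(y)\cap\beta(z)|$. The torso $\tau(x)$ is the graph obtained from $G[\beta(x)]$ by turning every adhesion of $x$ into a clique. The graph $G_x$ is obtained from $G$ by contracting each connected component of $G-\beta(x)$ into a single vertex, and then, among these contracted vertices, keeping only one representative per equivalence class of false twins (vertices with the same open neighborhood) and deleting the others. $K_h$ denotes the complete graph on $h$ vertices; a minor is obtained by vertex deletions, edge deletions and edge contractions. -}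

module Defs where

open import Data.Nat using (ℕ; zero; suc; _+_; _^_; _<_)
open import Data.Fin using (Fin; zero; suc; inject₁; fromℕ; toℕ)
open import Data.Product using (Σ; _×_; _,_; proj₁; proj₂; swap)
open import Data.Sum using (_⊎_; inj₁; inj₂)
open import Data.Empty using (⊥)
open import Relation.Nullary using (¬_)
open import Relation.Binary.PropositionalEquality using (_≡_; _≢_; refl; sym)
open import Function.Definitions using (Injective)

-- Vertices are drawn from Fin n; the actual vertex
-- set is the predicate V (this lets subgraphs/torsos/G_x live on the same
-- index set as G).

record Graph : Set₁ where
  field
    n     : ℕ
    V     : Fin n → Set
    E     : Fin n → Fin n → Set
    E-sym : ∀ {u v} → E u v → E v u
    E-irr : ∀ {v} → ¬ E v v
    E-V   : ∀ {u v} → E u v → V u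

open Graph public

data Path (G : Graph) (S : Fin (n G) → Set) : Fin (n G) → Fin (n G) → Set where
  here : ∀ {u} → S u → Path G S u u
  step : ∀ {u w v} → S u → E G u w → Path G S w v → Path G S u v

Connected : (G : Graph) → (Fin (n G) → Set) → Set
Connected G S = ∀ u v → S u → S v → Path G S u v

AtMost : {N : ℕ} → (Fin N → Set) → ℕ → Set
AtMost {N} P k = (f : Fin (suc k) → Fin N) → Injective _≡_ _≡_ f → ¬ (∀ i → P (f i))

Cycle : Graph → Set
Cycle G = Σ ℕ λ k → Σ (Fin (suc (suc (suc k))) → Fin (n G)) λ f →
  Injective _≡_ _≡_ f ×
  (∀ (i : Fin (suc (suc k))) → E G (f (inject₁ i)) (f (suc i))) ×
  E G (f (fromℕ (suc (suc k)))) (f zero)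

IsTree : Graph → Set
IsTree T = (Σ (Fin (n T)) (V T)) × Connected T (V T) × ¬ Cycle T

record IsTreeDecomposition (G T : Graph) (β : Fin (n T) → Fin (n G) → Set) : Set where
  field
    bags-V   : ∀ y v → β y v → V T y × V G v
    edge-cov : ∀ u v → E G u v → Σ (Fin (n T)) λ y → V T y × β y u × β y v
    vtx-nonempty : ∀ v → V G v → Σ (Fin (n T)) λ y → V T y × β y v
    vtx-subtree  : ∀ v → V G v → Connected T (λ y → V T y × β y v)

AdhesionAtMost : (G T : Graph) → (Fin (n T) → Fin (n G) → Set) → ℕ → Set
AdhesionAtMost G T β h =
  ∀ y z → V T y → V T z → y ≢ z → AtMost (λ v → β y v × β z v) h

module _ (G T : Graph) (β : Fin (n T) → Fin (n G) → Set) (x : Fin (n T)) where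

  private
    TE : Fin (n G) → Fin (n G) → Set
    TE u v = β x u × β x v ×
      (E G u v ⊎ (u ≢ v × Σ (Fin (n T)) λ y → V T y × y ≢ x × β y u × β y v))

    TE-sym : ∀ {u v} → TE u v → TE v u
    TE-sym (bu , bv , inj₁ e) = bv , bu , inj₁ (E-sym G e)
    TE-sym (bu , bv , inj₂ (ne , y , vy , yx , yu , yv)) =
      bv , bu , inj₂ ((λ eq → ne (sym eq)) , y , vy , yx , yv , yu)

    TE-irr : ∀ {v} → ¬ TE v v
    TE-irr (_ , _ , inj₁ e) = E-irr G e
    TE-irr (_ , _ , inj₂ (ne , _)) = ne refl

  torso : Graph
  torso = record
    { n = n G ; V = β x ; E = TE ; E-sym = TE-sym ; E-irr = TE-irr
    ; E-V = proj₁ }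

-- G_x: contract each component of G − β(x), then keep one representative
-- per class of false twins among the contracted vertices.
-- A contracted vertex is represented by a vertex v ∉ β(x) of G; the kept
-- representative of a class is the least-indexed vertex outside β(x) whose
-- component has that neighbourhood in β(x).

module _ (G : Graph) (B : Fin (n G) → Set) where

  Out : Fin (n G) → Set
  Out v = V G v × ¬ B v

  NB : Fin (n G) → Fin (n G) → Set
  NB v w = B w × Σ (Fin (n G)) λ c → Path G Out v c × E G c w

  SameN : Fin (n G) → Fin (n G) → Set
  SameN u v = ∀ w → (NB u w → NB v w) × (NB v w → NB u w)

  Keep : Fin (n G) → Set
  Keep v = (V G v × B v) ⊎
           (Out v × (∀ u → toℕ u < toℕ v → Out u → ¬ SameN u v))

  private
    XE : Fin (n G) → Fin (n G) → Set
    XE u v = Keep u × Keep v ×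
      ((B u × B v × E G u v) ⊎ (B u × Out v × NB v u) ⊎ (Out u × B v × NB u v))

    XE-sym : ∀ {u v} → XE u v → XE v u
    XE-sym (ku , kv , inj₁ (bu , bv , e)) = kv , ku , inj₁ (bv , bu , E-sym G e)
    XE-sym (ku , kv , inj₂ (inj₁ (bu , ov , nb))) = kv , ku , inj₂ (inj₂ (ov , bu , nb))
    XE-sym (ku , kv , inj₂ (inj₂ (ou , bv , nb))) = kv , ku , inj₂ (inj₁ (bv , ou , nb))

    XE-irr : ∀ {v} → ¬ XE v v
    XE-irr (_ , _ , inj₁ (_ , _ , e)) = E-irr G e
    XE-irr (_ , _ , inj₂ (inj₁ (b , o , _))) = proj₂ o b
    XE-irr (_ , _ , inj₂ (inj₂ (o , b , _))) = proj₂ o b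

  Gx-of : Graph
  Gx-of = record
    { n = n G ; V = Keep ; E = XE ; E-sym = XE-sym ; E-irr = XE-irr
    ; E-V = proj₁ }

Gx : (G T : Graph) → (Fin (n T) → Fin (n G) → Set) → Fin (n T) → Graph
Gx G T β x = Gx-of G (β x)

HasKMinor : Graph → ℕ → Set₁
HasKMinor G h = Σ (Fin h → Fin (n G) → Set) λ Br →
  (∀ i v → Br i v → V G v) ×
  (∀ i → Σ (Fin (n G)) (Br i)) ×
  (∀ i → Connected G (Br i)) ×
  (∀ i j v → i ≢ j → Br i v → ¬ Br j v) ×
  (∀ i j → i ≢ j → Σ (Fin (n G)) λ u → Σ (Fin (n G)) λ w → Br i u × Br j w × E G u w)

DegGt : (G : Graph) → Fin (n G) → ℕ → Set
DegGt G v d = Σ (Fin (suc d) → Fin (n G)) λ f →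
  Injective _≡_ _≡_ f × (∀ i → E G v (f i))

FewHighDeg : Graph → ℕ → ℕ → Set
FewHighDeg G k d = AtMost (λ v → V G v × DegGt G v d) k

-- The neighbourhood N(C) of a component C of G − β(x) is a clique of the torso: for a ∈ N(C),
-- follow the subtree of bags containing a from a bag meeting C to x; the last node y before x is
-- joined to the bags of C by a path avoiding x, so since T is acyclic y is the same neighbour of x
-- for every a ∈ N(C), and β(y) ∩ β(x) ⊇ N(C) is an adhesion.
--
-- (1) In a K_{h+1} model of G_x either some branch set misses β(x); as G_x − β(x) is edgeless it is
-- a single contracted vertex, and its neighbours in the other h branch sets form a K_h of the torso.
-- Or every branch set meets β(x), and its trace on β(x) is a torso branch set, since a detour
-- through a contracted vertex is replaced by a torso edge between two vertices of a clique N(C).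
--
-- (2) A contracted vertex of degree > h + 1 has h + 2 pairwise torso-adjacent neighbours, each of
-- torso degree > h. A vertex v ∈ β(x) with m ≤ h torso neighbours has at most m neighbours in β(x)
-- in G_x, and its contracted neighbours are pairwise non-twins whose neighbourhoods lie in
-- N_τ[v], so they are told apart by their traces on N_τ(v): at most 2^m of them.
--
-- Adjacency and neighbourhood membership are not decidable here, but every conclusion is a
-- negation, so decidability (and case splits over finitely many vertices) hold under ¬ ¬.

module Submission where

open import Defs
open import Data.Nat using (ℕ; suc; _+_; _^_; _≤_; s≤s; _≤?_)
open import Data.Nat.Properties using (≰⇒>; <-cmp; +-mono-≤; +-monoʳ-≤; ^-monoʳ-≤; n≤1+n; m<m+n; m^n>0)
open import Data.Fin
  using (Fin; zero; suc; inject₁; inject≤; fromℕ; toℕ; punchIn; join; splitAt; funToFin; finToFun; _≟_)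
open import Data.Fin.Properties
  using (pigeonhole; suc-injective; inject₁-injective; inject≤-injective; punchIn-injective; punchInᵢ≢i;
         toℕ-injective; splitAt-join; finToFun-funToFin; ∀-cons)
  renaming (<-irrefl to <ᶠ-irrefl)
open import Data.Product using (_×_; Σ; ∃; _,_; proj₁; proj₂; swap)
open import Data.Sum using (_⊎_; inj₁; inj₂)
open import Data.Sum.Properties using (inj₁-injective; inj₂-injective)
open import Data.Empty using (⊥-elim)
open import Data.List using (List; []; _∷_; length; lookup; filter; allFin)
open import Data.List.Membership.Propositional using (_∈_)
open import Data.List.Membership.Propositional.Properties using (∈-filter⁺; ∈-allFin; ∈-lookup)
open import Data.List.Relation.Unary.All as All using (All; []; _∷_)
open import Data.List.Relation.Unary.All.Properties using (¬Any⇒All¬; all-filter)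
open import Data.List.Relation.Unary.AllPairs using ([]; _∷_)
open import Data.List.Relation.Unary.Any using (here; there; index; any?)
open import Data.List.Relation.Unary.Any.Properties using (lookup-index)
open import Data.List.Relation.Unary.Unique.Propositional using (Unique)
open import Data.List.Relation.Unary.Unique.Propositional.Properties using (filter⁺; allFin⁺)
open import Function using (_∘_)
open import Function.Definitions using (Injective)
open import Relation.Binary.Definitions using (tri<; tri≈; tri>)
open import Relation.Binary.PropositionalEquality
  using (_≡_; _≢_; refl; sym; cong; subst; ≢-sym; module ≡-Reasoning)
open import Relation.Nullary using (¬_; Dec; yes; no)
open import Relation.Nullary.Decidable using (¬¬-excluded-middle)
open import Relation.Unary using (Decidable)

¬¬-Π : ∀ {m} {P : Fin m → Set} → (∀ i → ¬ ¬ P i) → ¬ ¬ (∀ i → P i)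
¬¬-Π {0}     _   k = k λ ()
¬¬-Π {suc m} ¬¬P k = ¬¬P zero λ p₀ → ¬¬-Π (¬¬P ∘ suc) λ ps → k (∀-cons p₀ ps)

¬¬-decidable : ∀ {m} (P : Fin m → Set) → ¬ ¬ Decidable P
¬¬-decidable P = ¬¬-Π λ _ → ¬¬-excluded-middle

indicator : ∀ {P : Set} → Dec P → Fin 2
indicator (yes _) = suc zero
indicator (no _)  = zero

indicator-reflects : ∀ {P Q : Set} (P? : Dec P) (Q? : Dec Q) → indicator P? ≡ indicator Q? → P → Q
indicator-reflects (yes _) (yes q) _  _ = q
indicator-reflects (no ¬p) _       _  p = ⊥-elim (¬p p)

join-injective : ∀ m n {p q : Fin m ⊎ Fin n} → join m n p ≡ join m n q → p ≡ q
join-injective m n {p} {q} eq = begin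
  p                      ≡⟨ splitAt-join m n p ⟨
  splitAt m (join m n p) ≡⟨ cong (splitAt m) eq ⟩
  splitAt m (join m n q) ≡⟨ splitAt-join m n q ⟩
  q                      ∎
  where open ≡-Reasoning

funToFin-injective : ∀ {m n} {f g : Fin m → Fin n} → funToFin f ≡ funToFin g → ∀ i → f i ≡ g i
funToFin-injective {f = f} {g} eq i = begin
  f i                     ≡⟨ finToFun-funToFin f i ⟨
  finToFun (funToFin f) i ≡⟨ cong (λ c → finToFun c i) eq ⟩
  finToFun (funToFin g) i ≡⟨ finToFun-funToFin g i ⟩
  g i                     ∎
  where open ≡-Reasoning

lookup-injective : ∀ {A : Set} {xs : List A} → Unique xs → ∀ i j → lookup xs i ≡ lookup xs j → i ≡ j
lookup-injective (_ ∷ _)     zero    zero    _  = refl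
lookup-injective (x∉xs ∷ _)  zero    (suc j) eq = ⊥-elim (All.lookup x∉xs (∈-lookup j) eq)
lookup-injective (x∉xs ∷ _)  (suc i) zero    eq = ⊥-elim (All.lookup x∉xs (∈-lookup i) (sym eq))
lookup-injective (_ ∷ uniq)  (suc i) (suc j) eq = cong suc (lookup-injective uniq i j eq)

module _ {G : Graph} where

  first∈ : ∀ {S u v} → Path G S u v → S u
  first∈ (here s)     = s
  first∈ (step s _ _) = s

  last∈ : ∀ {S u v} → Path G S u v → S v
  last∈ (here s)     = s
  last∈ (step _ _ p) = last∈ p

  mapᴾ : ∀ {S S′ : Fin (n G) → Set} {u v} → (∀ {w} → S w → S′ w) → Path G S u v → Path G S′ u v
  mapᴾ f (here s)     = here (f s)
  mapᴾ f (step s e p) = step (f s) e (mapᴾ f p)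

  infixr 5 _++ᴾ_
  _++ᴾ_ : ∀ {S u v w} → Path G S u v → Path G S v w → Path G S u w
  here _     ++ᴾ q = q
  step s e p ++ᴾ q = step s e (p ++ᴾ q)

  reverseᴾ : ∀ {S u v} → Path G S u v → Path G S v u
  reverseᴾ (here s)     = here s
  reverseᴾ (step s e p) = reverseᴾ p ++ᴾ step (first∈ p) (E-sym G e) (here s)

  before-first-visit : ∀ {S y x} → y ≢ x → Path G S y x →
                       Σ (Fin (n G)) λ z → E G z x × S z × Path G (λ w → S w × w ≢ x) y z
  before-first-visit y≢x (here _) = ⊥-elim (y≢x refl)
  before-first-visit {x = x} y≢x (step {w = w} s e p) with w ≟ x
  ... | yes refl = _ , e , s , here (s , y≢x)
  ... | no w≢x with before-first-visit w≢x p
  ...   | z , z~x , sz , q = z , z~x , sz , step (s , y≢x) e q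

data Walk (G : Graph) : Fin (n G) → Fin (n G) → List (Fin (n G)) → Set where
  stop : ∀ {a} → Walk G a a (a ∷ [])
  _◅_  : ∀ {a b c xs} → E G a b → Walk G b c (b ∷ xs) → Walk G a c (a ∷ b ∷ xs)

infixr 5 _◅_

module _ {G : Graph} where

  infixr 5 _◅′_
  _◅′_ : ∀ {a b c xs} → E G a b → Walk G b c xs → Walk G a c (a ∷ xs)
  e ◅′ stop     = e ◅ stop
  e ◅′ (e′ ◅ w) = e ◅ e′ ◅ w

  walk-suffix : ∀ {S : Fin (n G) → Set} {a c u xs} → Walk G a c xs → Unique xs → All S xs → u ∈ xs →
                Σ (List (Fin (n G))) λ ys → Walk G u c ys × Unique ys × All S ys
  walk-suffix stop     uniq       all       (here refl) = _ , stop , uniq , all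
  walk-suffix (e ◅ w)  uniq       all       (here refl) = _ , e ◅ w , uniq , all
  walk-suffix (_ ◅ w)  (_ ∷ uniq) (_ ∷ all) (there u∈) = walk-suffix w uniq all u∈

  path⇒simple-walk : ∀ {S u v} → Path G S u v →
                     Σ (List (Fin (n G))) λ xs → Walk G u v xs × Unique xs × All S xs
  path⇒simple-walk (here s) = _ , stop , [] ∷ [] , s ∷ []
  path⇒simple-walk (step {u} s e p) with path⇒simple-walk p
  ... | xs , w , uniq , all with any? (u ≟_) xs
  ...   | yes u∈xs = walk-suffix w uniq all u∈xs
  ...   | no  u∉xs = u ∷ xs , e ◅′ w , ¬Any⇒All¬ xs u∉xs ∷ uniq , s ∷ all

  walk-edge : ∀ {a c xs} → Walk G a c (a ∷ xs) → ∀ (i : Fin (length xs)) →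
              E G (lookup (a ∷ xs) (inject₁ i)) (lookup (a ∷ xs) (suc i))
  walk-edge (e ◅ _) zero    = e
  walk-edge (_ ◅ w) (suc i) = walk-edge w i

  walk-last : ∀ {a c xs} → Walk G a c (a ∷ xs) → lookup (a ∷ xs) (fromℕ (length xs)) ≡ c
  walk-last stop    = refl
  walk-last (_ ◅ w) = walk-last w

  closed-walk⇒Cycle : ∀ {a b d c xs} → Walk G a c (a ∷ b ∷ d ∷ xs) → Unique (a ∷ b ∷ d ∷ xs) →
                      E G c a → Cycle G
  closed-walk⇒Cycle {a} {b} {d} {xs = xs} w uniq c~a =
    length xs , lookup (a ∷ b ∷ d ∷ xs) , (λ {i} {j} → lookup-injective uniq i j) , walk-edge w ,
    subst (λ z → E G z _) (sym (walk-last w)) c~a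

  acyclic⇒neighbours-equal : ¬ Cycle G → ∀ {x y₁ y₂} → E G y₁ x → E G y₂ x →
                             Path G (_≢ x) y₁ y₂ → y₁ ≡ y₂
  acyclic⇒neighbours-equal acyclic y₁~x y₂~x p with path⇒simple-walk p
  ... | _ , stop    , _    , _     = refl
  ... | _ , e ◅ w   , uniq , avoid =
    ⊥-elim (acyclic (closed-walk⇒Cycle (E-sym G y₁~x ◅ e ◅ w) (All.map ≢-sym avoid ∷ uniq) y₂~x))

module _ (G : Graph) where

  IsClique : ∀ {k} → (Fin k → Fin (n G)) → Set
  IsClique g = ∀ i j → i ≢ j → E G (g i) (g j)

  clique-injective : ∀ {k} {g : Fin k → Fin (n G)} → IsClique g → Injective _≡_ _≡_ g
  clique-injective {g = g} clique {i} {j} gi≡gj with i ≟ j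
  ... | yes i≡j = i≡j
  ... | no  i≢j = ⊥-elim (E-irr G (subst (E G (g i)) (sym gi≡gj) (clique i j i≢j)))

  clique⇒HasKMinor : ∀ {k} (g : Fin k → Fin (n G)) → (∀ i → V G (g i)) → IsClique g → HasKMinor G k
  clique⇒HasKMinor g g∈G clique =
      (λ i v → v ≡ g i)
    , (λ { i _ refl → g∈G i })
    , (λ i → g i , refl)
    , (λ { i _ _ refl refl → here refl })
    , (λ { i j _ i≢j refl gi≡gj → i≢j (clique-injective clique gi≡gj) })
    , λ i j i≢j → g i , g j , refl , refl , clique i j i≢j

  clique⇒DegGt : ∀ {d} {g : Fin (suc (suc d)) → Fin (n G)} → IsClique g → ∀ i → DegGt G (g i) d
  clique⇒DegGt {g = g} clique i =
    g ∘ punchIn i ,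
    (λ eq → punchIn-injective i _ _ (clique-injective clique eq)) ,
    λ j → clique i (punchIn i j) (≢-sym (punchInᵢ≢i i j))

  DegGt-weaken : ∀ {v d d′} → d ≤ d′ → DegGt G v d′ → DegGt G v d
  DegGt-weaken d≤d′ (f , f-inj , v~f) = f ∘ ι , (λ eq → inject≤-injective _ _ _ _ (f-inj eq)) , v~f ∘ ι
    where ι = λ i → inject≤ i (s≤s d≤d′)

  ¬DegGt⇒length≤ : ∀ {v d ws} → Unique ws → All (E G v) ws → ¬ DegGt G v d → length ws ≤ d
  ¬DegGt⇒length≤ {d = d} {ws} uniq v~ws low with length ws ≤? d
  ... | yes ≤d = ≤d
  ... | no  ≰d = ⊥-elim (low (lookup ws ∘ ι , ι-injective , λ i → All.lookup v~ws (∈-lookup (ι i))))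
    where
      ι = λ i → inject≤ i (≰⇒> ≰d)
      ι-injective : Injective _≡_ _≡_ (lookup ws ∘ ι)
      ι-injective eq = inject≤-injective _ _ _ _ (lookup-injective uniq _ _ eq)

  HasKMinor-suc⇒HasKMinor : ∀ {k} → HasKMinor G (suc k) → HasKMinor G k
  HasKMinor-suc⇒HasKMinor (Br , Br⊆V , Br≠∅ , Br-conn , Br-disj , Br-adj) =
    Br ∘ suc , Br⊆V ∘ suc , Br≠∅ ∘ suc , Br-conn ∘ suc ,
    (λ i j v i≢j → Br-disj (suc i) (suc j) v (i≢j ∘ suc-injective)) ,
    λ i j i≢j → Br-adj (suc i) (suc j) (i≢j ∘ suc-injective)

module _ (G : Graph) (B : Fin (n G) → Set) where

  Gx-edge-from-outside : ∀ {u w} → ¬ B u → E (Gx-of G B) u w → B w × NB G B u w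
  Gx-edge-from-outside u∉B (_ , _ , inj₁ (u∈B , _))        = ⊥-elim (u∉B u∈B)
  Gx-edge-from-outside u∉B (_ , _ , inj₂ (inj₁ (u∈B , _))) = ⊥-elim (u∉B u∈B)
  Gx-edge-from-outside _   (_ , _ , inj₂ (inj₂ (_ , w∈B , nb))) = w∈B , nb

  Gx-edge-from-inside : ∀ {u w} → B u → E (Gx-of G B) u w →
                        (B w × E G u w) ⊎ (Out G B w × NB G B w u)
  Gx-edge-from-inside _   (_ , _ , inj₁ (_ , w∈B , e))             = inj₁ (w∈B , e)
  Gx-edge-from-inside _   (_ , _ , inj₂ (inj₁ (_ , w-out , nb)))   = inj₂ (w-out , nb)
  Gx-edge-from-inside u∈B (_ , _ , inj₂ (inj₂ ((_ , u∉B) , _)))    = ⊥-elim (u∉B u∈B)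

  Gx-edge-touches-B : ∀ {u w} → E (Gx-of G B) u w → B u ⊎ B w
  Gx-edge-touches-B (_ , _ , inj₁ (u∈B , _))              = inj₁ u∈B
  Gx-edge-touches-B (_ , _ , inj₂ (inj₁ (u∈B , _)))       = inj₁ u∈B
  Gx-edge-touches-B (_ , _ , inj₂ (inj₂ (_ , w∈B , _)))   = inj₂ w∈B

  Gx-path-avoiding-B-trivial : ∀ {P c u} → (∀ {z} → P z → ¬ B z) → Path (Gx-of G B) P c u → u ≡ c
  Gx-path-avoiding-B-trivial _       (here _)         = refl
  Gx-path-avoiding-B-trivial outside (step c∈P e p) =
    ⊥-elim (outside (first∈ p) (proj₁ (Gx-edge-from-outside (outside c∈P) e)))

  Gx-path-enters-B : ∀ {P w b} → Path (Gx-of G B) P w b → B b → ¬ B w →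
                   Σ (Fin (n G)) λ w′ → P w′ × B w′ × NB G B w w′
  Gx-path-enters-B (here _)       b∈B w∉B = ⊥-elim (w∉B b∈B)
  Gx-path-enters-B (step _ e p)   _   w∉B = _ , first∈ p , Gx-edge-from-outside w∉B e

  kept-twins-equal : ∀ {w w′} → ¬ B w → ¬ B w′ → Keep G B w → Keep G B w′ → SameN G B w w′ → w ≡ w′
  kept-twins-equal w∉B _    (inj₁ (_ , w∈B))  _                 _ = ⊥-elim (w∉B w∈B)
  kept-twins-equal _   w′∉B _                 (inj₁ (_ , w′∈B)) _ = ⊥-elim (w′∉B w′∈B)
  kept-twins-equal {w} {w′} _ _ (inj₂ (w-out , w-least)) (inj₂ (w′-out , w′-least)) same
    with <-cmp (toℕ w) (toℕ w′)
  ... | tri< w<w′ _ _ = ⊥-elim (w′-least w w<w′ w-out same)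
  ... | tri≈ _ w≡w′ _ = toℕ-injective w≡w′
  ... | tri> _ _ w′<w = ⊥-elim (w-least w′ w′<w w′-out (swap ∘ same))

module _ {G T : Graph} {β : Fin (n T) → Fin (n G) → Set} (td : IsTreeDecomposition G T β) where
  open IsTreeDecomposition td

  path⇒node-path : ∀ {P : Fin (n G) → Set} {u v t t′} → Path G (λ w → V G w × P w) u v →
                   V T t → β t u → V T t′ → β t′ v → Path T (λ y → ∃ λ w → P w × β y w) t t′
  path⇒node-path {u = u} (here (u∈G , Pu)) t∈T u∈t t′∈T u∈t′ =
    mapᴾ (λ (_ , u∈y) → u , Pu , u∈y) (vtx-subtree u u∈G _ _ (t∈T , u∈t) (t′∈T , u∈t′))
  path⇒node-path (step {u} {w} (u∈G , Pu) e p) t∈T u∈t t′∈T v∈t′ with edge-cov u w e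
  ... | z , z∈T , u∈z , w∈z =
    mapᴾ (λ (_ , u∈y) → u , Pu , u∈y) (vtx-subtree u u∈G _ _ (t∈T , u∈t) (z∈T , u∈z)) ++ᴾ
    path⇒node-path p z∈T w∈z t′∈T v∈t′

  module _ (acyclic : ¬ Cycle T) {x : Fin (n T)} (x∈T : V T x) where

    private
      outside-node : ∀ {y} → (∃ λ w → ¬ β x w × β y w) → y ≢ x
      outside-node (_ , w∉x , w∈y) refl = w∉x w∈y

    exit-node : ∀ {c a t} → V T t → β t c → NB G (β x) c a →
                Σ (Fin (n T)) λ y → E T y x × β y a × Path T (_≢ x) y t
    exit-node {a = a} t∈T c∈t (a∈x , c₁ , c⇝c₁ , c₁~a) with edge-cov c₁ a c₁~a
    ... | y₁ , y₁∈T , c₁∈y₁ , a∈y₁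
      with before-first-visit (outside-node (c₁ , proj₂ (last∈ c⇝c₁) , c₁∈y₁))
             (vtx-subtree a (proj₂ (bags-V x a a∈x)) y₁ x (y₁∈T , a∈y₁) (x∈T , a∈x))
    ... | y , y~x , (_ , a∈y) , y₁⇝y =
      y , y~x , a∈y ,
      reverseᴾ (mapᴾ proj₂ y₁⇝y) ++ᴾ
      mapᴾ outside-node (path⇒node-path (reverseᴾ c⇝c₁) y₁∈T c₁∈y₁ t∈T c∈t)

    torso-clique : ∀ {c a b} → NB G (β x) c a → NB G (β x) c b → a ≢ b → E (torso G T β x) a b
    torso-clique {c} nba@(a∈x , _ , c⇝c₁ , _) nbb@(b∈x , _) a≢b
      with vtx-nonempty c (proj₁ (first∈ c⇝c₁))
    ... | t , t∈T , c∈t with exit-node t∈T c∈t nba | exit-node t∈T c∈t nbb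
    ... | y , y~x , a∈y , y⇝t | y′ , y′~x , b∈y′ , y′⇝t
      with acyclic⇒neighbours-equal acyclic y~x y′~x (y⇝t ++ᴾ reverseᴾ y′⇝t)
    ... | refl = a∈x , b∈x , inj₂ (a≢b , y , E-V T y~x , (λ { refl → E-irr T y~x }) , a∈y , b∈y′)

module Completion
  (G : Graph) (B : Fin (n G) → Set)
  (_~_ : Fin (n G) → Fin (n G) → Set)
  (~-sym : ∀ {u v} → u ~ v → v ~ u) (~-irr : ∀ {v} → ¬ v ~ v) (~-B : ∀ {u v} → u ~ v → B u)
  (edge⇒~ : ∀ {u v} → B u → B v → E G u v → u ~ v)
  (neighbourhood-clique : ∀ {c a b} → NB G B c a → NB G B c b → a ≢ b → a ~ b)
  where

  H : Graph
  H = record { n = n G ; V = B ; E = _~_ ; E-sym = ~-sym ; E-irr = ~-irr ; E-V = ~-B }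

  private
    GX : Graph
    GX = Gx-of G B

  Meets : ∀ {k} → HasKMinor GX k → Fin k → Set
  Meets (Br , _) i = ∃ λ v → Br i v × B v

  missing-branch⇒clique : ∀ {k} (M : HasKMinor GX (suc k)) i → ¬ Meets M i → HasKMinor H k
  missing-branch⇒clique (Br , _ , Br≠∅ , Br-conn , Br-disj , Br-adj) i missing =
    clique⇒HasKMinor H (proj₁ ∘ contact) contact∈B contact-clique
    where
      c = proj₁ (Br≠∅ i)
      c∈Br = proj₂ (Br≠∅ i)

      outside : ∀ {z} → Br i z → ¬ B z
      outside z∈Br z∈B = missing (_ , z∈Br , z∈B)

      contact : ∀ j → Σ (Fin (n G)) λ w → Br (punchIn i j) w × B w × NB G B c w
      contact j with Br-adj i (punchIn i j) (≢-sym (punchInᵢ≢i i j))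
      ... | u , w , u∈Br , w∈Br , u~w with Gx-path-avoiding-B-trivial G B outside (Br-conn i c u c∈Br u∈Br)
      ... | refl = w , w∈Br , Gx-edge-from-outside G B (outside c∈Br) u~w

      contact∈B : ∀ j → B (proj₁ (contact j))
      contact∈B j = proj₁ (proj₂ (proj₂ (contact j)))

      contact-clique : IsClique H (proj₁ ∘ contact)
      contact-clique j j′ j≢j′ with contact j | contact j′
      ... | w , w∈Br , _ , c-w | w′ , w′∈Br , _ , c-w′ =
        neighbourhood-clique c-w c-w′
          λ { refl → Br-disj _ _ w (j≢j′ ∘ punchIn-injective i j j′) w∈Br w′∈Br }

  Gx-path⇒H-path : ∀ {P u v} → Path GX P u v → B u → B v → Path H (λ z → P z × B z) u v
  Gx-path⇒H-path (here Pu) u∈B _ = here (Pu , u∈B)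
  Gx-path⇒H-path (step Pu e p) u∈B v∈B with Gx-edge-from-inside G B u∈B e
  ... | inj₁ (w∈B , e′) = step (Pu , u∈B) (edge⇒~ u∈B w∈B e′) (Gx-path⇒H-path p w∈B v∈B)
  Gx-path⇒H-path (step _ _ (here _)) _ v∈B | inj₂ ((_ , v∉B) , _) = ⊥-elim (v∉B v∈B)
  Gx-path⇒H-path {u = u} (step Pu _ (step {w = w′} _ e′ p)) u∈B v∈B | inj₂ ((_ , w∉B) , w-u)
    with Gx-edge-from-outside G B w∉B e′ | u ≟ w′
  ... | _    , _     | yes refl = Gx-path⇒H-path p u∈B v∈B
  ... | w′∈B , w-w′  | no u≢w′  =
    step (Pu , u∈B) (neighbourhood-clique w-u w-w′ u≢w′) (Gx-path⇒H-path p w′∈B v∈B)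

  meeting-branches⇒minor : ∀ {k} (M : HasKMinor GX k) → (∀ i → Meets M i) → HasKMinor H k
  meeting-branches⇒minor (Br , _ , _ , Br-conn , Br-disj , Br-adj) meets =
      (λ i v → Br i v × B v)
    , (λ _ _ → proj₂)
    , meets
    , (λ i u v (u∈Br , u∈B) (v∈Br , v∈B) → Gx-path⇒H-path (Br-conn i u v u∈Br v∈Br) u∈B v∈B)
    , (λ i j v i≢j (v∈Brᵢ , _) (v∈Brⱼ , _) → Br-disj i j v i≢j v∈Brᵢ v∈Brⱼ)
    , adjacent
    where
      edge-into : ∀ {i j u w} → i ≢ j → Br i u → B u → Br j w → E GX u w →
                  Σ (Fin (n G)) λ w′ → (Br j w′ × B w′) × u ~ w′
      edge-into {i} {j} {u} {w} i≢j u∈Br u∈B w∈Br u~w with Gx-edge-from-inside G B u∈B u~w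
      ... | inj₁ (w∈B , e) = w , (w∈Br , w∈B) , edge⇒~ u∈B w∈B e
      ... | inj₂ ((_ , w∉B) , w-u) with meets j
      ... | b , b∈Br , b∈B with Gx-path-enters-B G B (Br-conn j w b w∈Br b∈Br) b∈B w∉B
      ... | w′ , w′∈Br , w′∈B , w-w′ =
        w′ , (w′∈Br , w′∈B) , neighbourhood-clique w-u w-w′ λ { refl → Br-disj i j u i≢j u∈Br w′∈Br }

      adjacent : ∀ i j → i ≢ j → Σ (Fin (n G)) λ u → Σ (Fin (n G)) λ w →
                 (Br i u × B u) × (Br j w × B w) × u ~ w
      adjacent i j i≢j with Br-adj i j i≢j
      ... | u , w , u∈Br , w∈Br , u~w with Gx-edge-touches-B G B u~w
      ... | inj₁ u∈B = let w′ , w′∈Br , u~w′ = edge-into i≢j u∈Br u∈B w∈Br u~w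
                       in u , w′ , (u∈Br , u∈B) , w′∈Br , u~w′
      ... | inj₂ w∈B = let u′ , u′∈Br , w~u′ = edge-into (≢-sym i≢j) w∈Br w∈B u∈Br (E-sym GX u~w)
                       in u′ , w , u′∈Br , (w∈Br , w∈B) , ~-sym w~u′

  Gx-K-minor-free : ∀ k → ¬ HasKMinor H k → ¬ HasKMinor GX (suc k)
  Gx-K-minor-free k no-minor M =
    ¬¬-Π (λ i missing → no-minor (missing-branch⇒clique M i missing))
         (no-minor ∘ HasKMinor-suc⇒HasKMinor H ∘ meeting-branches⇒minor M)

  contracted-low-degree : ∀ {k v} → FewHighDeg H k k → Out G B v → ¬ DegGt GX v (suc k)
  contracted-low-degree {v = v} few (_ , v∉B) (g , g-inj , v~g) =
    few (g ∘ inject₁) (λ eq → inject₁-injective (g-inj eq))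
        λ i → proj₁ (contact (inject₁ i)) , clique⇒DegGt H clique (inject₁ i)
    where
      contact : ∀ i → B (g i) × NB G B v (g i)
      contact i = Gx-edge-from-outside G B v∉B (v~g i)

      clique : IsClique H g
      clique i j i≢j = neighbourhood-clique (proj₂ (contact i)) (proj₂ (contact j)) (i≢j ∘ g-inj)

  module NeighbourCode {v d} (v∈B : B v) (low : ¬ DegGt H v d)
                       (~? : Decidable (v ~_)) (NB? : ∀ c → Decidable (NB G B c)) where

    ws : List (Fin (n G))
    ws = filter ~? (allFin (n G))

    m : ℕ
    m = length ws

    m≤d : m ≤ d
    m≤d = ¬DegGt⇒length≤ H (filter⁺ ~? (allFin⁺ _)) (all-filter ~? (allFin _)) low

    ∈ws : ∀ {w} → v ~ w → w ∈ ws
    ∈ws v~w = ∈-filter⁺ ~? (∈-allFin _) v~w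

    trace : Fin (n G) → Fin m → Fin 2
    trace c i = indicator (NB? c (lookup ws i))

    code : ∀ {w} → (B w × E G v w) ⊎ (Out G B w × NB G B w v) → Fin m ⊎ Fin (2 ^ m)
    code     (inj₁ (w∈B , e)) = inj₁ (index (∈ws (edge⇒~ v∈B w∈B e)))
    code {w} (inj₂ _)         = inj₂ (funToFin (trace w))

    trace-determines-NB : ∀ {w w′} → NB G B w v → NB G B w′ v → (∀ i → trace w i ≡ trace w′ i) →
                          ∀ z → NB G B w z → NB G B w′ z
    trace-determines-NB {w} {w′} w-v w′-v same z w-z with z ≟ v
    ... | yes refl = w′-v
    ... | no  z≢v  =
      subst (NB G B w′) (sym z≡) (indicator-reflects (NB? w _) (NB? w′ _) (same i) (subst (NB G B w) z≡ w-z))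
      where
        z∈ws = ∈ws (neighbourhood-clique w-v w-z (≢-sym z≢v))
        i = index z∈ws
        z≡ : z ≡ lookup ws i
        z≡ = lookup-index z∈ws

    code-injective : ∀ {w w′} s s′ → Keep G B w → Keep G B w′ → code {w} s ≡ code {w′} s′ → w ≡ w′
    code-injective {w} {w′} (inj₁ (w∈B , e)) (inj₁ (w′∈B , e′)) _ _ eq = begin
      w                        ≡⟨ lookup-index w∈ws ⟩
      lookup ws (index w∈ws)   ≡⟨ cong (lookup ws) (inj₁-injective eq) ⟩
      lookup ws (index w′∈ws)  ≡⟨ lookup-index w′∈ws ⟨
      w′                       ∎
      where
        open ≡-Reasoning
        w∈ws = ∈ws (edge⇒~ v∈B w∈B e)
        w′∈ws = ∈ws (edge⇒~ v∈B w′∈B e′)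
    code-injective {w} {w′} (inj₂ ((_ , w∉B) , w-v)) (inj₂ ((_ , w′∉B) , w′-v)) kw kw′ eq =
      kept-twins-equal G B w∉B w′∉B kw kw′ λ z →
        trace-determines-NB w-v w′-v same z , trace-determines-NB w′-v w-v (sym ∘ same) z
      where
        same : ∀ i → trace w i ≡ trace w′ i
        same = funToFin-injective (inj₂-injective eq)
    code-injective (inj₁ _) (inj₂ _) _ _ ()
    code-injective (inj₂ _) (inj₁ _) _ _ ()

    edge-code : ∀ {w} → E GX v w → Fin (m + 2 ^ m)
    edge-code e = join m (2 ^ m) (code (Gx-edge-from-inside G B v∈B e))

    edge-code-injective : ∀ {w w′} (e : E GX v w) (e′ : E GX v w′) → edge-code e ≡ edge-code e′ → w ≡ w′
    edge-code-injective e e′ eq =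
      code-injective (Gx-edge-from-inside G B v∈B e) (Gx-edge-from-inside G B v∈B e′)
                     (E-V GX (E-sym GX e)) (E-V GX (E-sym GX e′)) (join-injective m (2 ^ m) eq)

    Gx-low-degree : ¬ DegGt GX v (d + 2 ^ d)
    Gx-low-degree (g , g-inj , v~g) with pigeonhole (s≤s (+-mono-≤ m≤d (^-monoʳ-≤ 2 m≤d))) (edge-code ∘ v~g)
    ... | i , j , i<j , eq = <ᶠ-irrefl (g-inj (edge-code-injective (v~g i) (v~g j) eq)) i<j

  inside-low-degree : ∀ {v} d → B v → ¬ DegGt H v d → ¬ DegGt GX v (d + 2 ^ d)
  inside-low-degree {v} d v∈B low high =
    ¬¬-decidable (v ~_) λ ~? → ¬¬-Π (λ c → ¬¬-decidable (NB G B c)) λ NB? →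
    NeighbourCode.Gx-low-degree v∈B low ~? NB? high

  Gx-few-high-degree : ∀ k → FewHighDeg H k k → FewHighDeg GX k (k + 2 ^ suc k)
  Gx-few-high-degree k few f f-inj f-high = ¬¬-Π high-in-H (few f f-inj)
    where
      high-in-H : ∀ i → ¬ ¬ (B (f i) × DegGt H (f i) k)
      high-in-H i ¬high with f-high i
      ... | inj₁ (_ , fi∈B) , high =
        inside-low-degree k fi∈B (λ highH → ¬high (fi∈B , highH))
          (DegGt-weaken GX (+-monoʳ-≤ k (^-monoʳ-≤ 2 (n≤1+n k))) high)
      ... | inj₂ (fi-out , _) , high =
        contracted-low-degree few fi-out (DegGt-weaken GX (m<m+n k (m^n>0 2 (suc k))) high)

lemma11 : (h : ℕ) (G T : Graph) (β : Fin (Graph.n T) → Fin (Graph.n G) → Set) →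
          IsTree T → IsTreeDecomposition G T β → AdhesionAtMost G T β h →
          (x : Fin (Graph.n T)) → Graph.V T x →
          ((¬ HasKMinor (torso G T β x) h → ¬ HasKMinor (Gx G T β x) (suc h)) ×
           (FewHighDeg (torso G T β x) h h →
            FewHighDeg (Gx G T β x) h (h + 2 ^ (suc h))))
lemma11 h G T β (_ , _ , acyclic) td _ x x∈T = Gx-K-minor-free h , Gx-few-high-degree h
  where
    τ = torso G T β x
    open Completion G (β x) (E τ) (E-sym τ) (E-irr τ) (E-V τ) (λ a∈x b∈x e → a∈x , b∈x , inj₁ e)
                    (torso-clique td acyclic x∈T)
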